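{- Let $S\subseteq A^A$ be a fully-transpositional function semigroup. If $S$ contains a function $f$ such that $f[A\setminus\mathrm{Idp}(f)]$ is finite and $f$ is not one-to-one, then $S$ contains a semi-constant function.
   Context: A function semigroup on a nonempty set $A$ is a nonempty $S\subseteq A^A$ closed under composition; fully-transpositional means it contains every transposition of $A$ (permutation moving exactly two elements). For $f\colon A\to A$, $\mathrm{Idp}(f)=\{a\in A: f^{ -1}[\{a\}]=\{a\}\}$. $f\colon A\to A$ is semi-constant if there is $B\subseteq A$ with $|B|\geq2$ such that $f\restriction B$ is constant and $f\restriction(A\setminus B)$ is the identity. -}

module Defs where

open import Level using (0ℓ)
open import Data.Product using (Σ; ∃; _×_; _,_)
open import Data.List using (List)
open import Data.List.Membership.Propositional using (_∈_)
open import Relation.Nullary using (¬_)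
open import Relation.Binary.PropositionalEquality using (_≡_)
open import Function using (_∘_)

record FunctionSemigroup (A : Set) (S : (A → A) → Set) : Set where
  field
    nonempty : Σ (A → A) S
    closed   : ∀ {f g : A → A} → S f → S g → S (f ∘ g)

IsTransposition : {A : Set} → (A → A) → Set
IsTransposition {A} t =
  Σ A λ a → Σ A λ b →
    ¬ (a ≡ b) × t a ≡ b × t b ≡ a ×
    (∀ x → ¬ (x ≡ a) → ¬ (x ≡ b) → t x ≡ x)

FullyTranspositional : {A : Set} → ((A → A) → Set) → Set
FullyTranspositional {A} S = ∀ (t : A → A) → IsTransposition t → S t

InIdp : {A : Set} → (A → A) → A → Set
InIdp {A} f a = ∀ x → (f x ≡ a → x ≡ a) × (x ≡ a → f x ≡ a)

FiniteImageOutsideIdp : {A : Set} → (A → A) → Set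
FiniteImageOutsideIdp {A} f =
  Σ (List A) λ L → ∀ x → ¬ InIdp f x → f x ∈ L

NotInjective : {A : Set} → (A → A) → Set
NotInjective {A} f = ¬ (∀ x y → f x ≡ f y → x ≡ y)

SemiConstant : {A : Set} → (A → A) → Set₁
SemiConstant {A} f =
  Σ (A → Set) λ B →
    (Σ A λ a → Σ A λ b → ¬ (a ≡ b) × B a × B b) ×
    (Σ A λ c → ∀ x → B x → f x ≡ c) ×
    (∀ x → ¬ B x → f x ≡ x)

-- Write  Moved = A ∖ Idp(f).  We track functions h ∈ S together with a
-- finite list Vs ⊆ Moved such that h fixes Idp(f) pointwise, maps Moved
-- into Vs and identifies a fixed pair x₀ ≠ y₀ with f x₀ = f y₀
-- (invariant 'Approximant').  The member f itself is such an h.  If Vs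
-- has at most one distinct entry, h is constant on Moved and the identity
-- elsewhere, i.e. semi-constant with B = Moved.  Otherwise the list can be
-- shortened by one of two moves:
--   * if h collapses two entries p ≠ q of Vs, pass to h ∘ h, whose image
--     of Moved lies in h[Vs ∖ {q}];
--   * if h is injective on Vs, there is w ∈ Moved ∖ Vs (else h would be
--     injective on Moved, contradicting h x₀ = h y₀), and for suitable
--     v ∈ Vs the function h ∘ (v w) ∘ h avoids h v on Moved.
-- Well-founded recursion on the length of Vs finishes the proof.  The
-- argument is classical: excluded middle supplies decidable equality (for
-- transpositions and list removal) and the case distinctions.

module Submission where

open import Defs
open import Level using (0ℓ)
open import Axiom.ExcludedMiddle using (ExcludedMiddle)
open import Axiom.DoubleNegationElimination using (em⇒dne)
open import Data.Product using (Σ; _×_; _,_; proj₁; proj₂)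
open import Data.Nat using (_<_)
open import Data.Nat.Induction using (<-wellFounded)
open import Data.Nat.Properties using (≤-<-trans; ≤-reflexive)
open import Data.List using (List; length; filter; map)
open import Data.List.Properties using (length-map; filter-notAll)
open import Data.List.Membership.Propositional using (_∈_; _∉_)
open import Data.List.Membership.Propositional.Properties
  using (∈-filter⁺; ∈-filter⁻; ∈-map⁺; ∈-map⁻)
import Data.List.Relation.Unary.Any as Any
open import Induction.WellFounded using (Acc; acc)
open import Relation.Binary.Definitions using (DecidableEquality)
open import Relation.Nullary using (¬_; Dec; yes; no; ¬?; contradiction)
open import Relation.Binary.PropositionalEquality
open import Function using (_∘_)

module Transposition {A : Set} (_≟_ : DecidableEquality A) where

  swap : A → A → A → A
  swap v w x with x ≟ v
  ... | yes _ = w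
  ... | no _ with x ≟ w
  ...   | yes _ = v
  ...   | no _ = x

  swap-fixes : ∀ {v w x} → x ≢ v → x ≢ w → swap v w x ≡ x
  swap-fixes {v} {w} {x} x≢v x≢w with x ≟ v
  ... | yes x≡v = contradiction x≡v x≢v
  ... | no _ with x ≟ w
  ...   | yes x≡w = contradiction x≡w x≢w
  ...   | no _ = refl

  swap-left : ∀ v w → swap v w v ≡ w
  swap-left v w with v ≟ v
  ... | yes _ = refl
  ... | no v≢v = contradiction refl v≢v

  swap-right : ∀ {v w} → v ≢ w → swap v w w ≡ v
  swap-right {v} {w} v≢w with w ≟ v
  ... | yes w≡v = contradiction (sym w≡v) v≢w
  ... | no _ with w ≟ w
  ...   | yes _ = refl
  ...   | no w≢w = contradiction refl w≢w

  swap-isTransposition : ∀ {v w} → v ≢ w → IsTransposition (swap v w)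
  swap-isTransposition {v} {w} v≢w =
    v , w , v≢w , swap-left v w , swap-right v≢w , λ x → swap-fixes

module Removal {A : Set} (_≟_ : DecidableEquality A) where

  _without_ : List A → A → List A
  xs without y = filter (λ z → ¬? (z ≟ y)) xs

  without-shorter : ∀ {y} xs → y ∈ xs → length (xs without y) < length xs
  without-shorter xs y∈xs =
    filter-notAll (λ z → ¬? (z ≟ _)) xs (Any.map (λ y≡z z≢y → z≢y (sym y≡z)) y∈xs)

  ∈-without⁺ : ∀ {y z xs} → z ∈ xs → z ≢ y → z ∈ xs without y
  ∈-without⁺ = ∈-filter⁺ (λ z → ¬? (z ≟ _))

  ∈-without⁻ : ∀ {y z} xs → z ∈ xs without y → z ∈ xs
  ∈-without⁻ xs z∈ = proj₁ (∈-filter⁻ (λ z → ¬? (z ≟ _)) {xs = xs} z∈)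

module Idempotents {A : Set} (f : A → A) where

  Moved : A → Set
  Moved x = ¬ InIdp f x

  idp-fixed : ∀ {a} → InIdp f a → f a ≡ a
  idp-fixed {a} a∈Idp = proj₂ (a∈Idp a) refl

  -- f maps A ∖ Idp(f) into itself: if f x ∈ Idp(f) then x = f x ∈ Idp(f).
  moved-closed : ∀ {x} → Moved x → Moved (f x)
  moved-closed {x} x-moved fx∈Idp =
    x-moved (subst (InIdp f) (sym (proj₁ (fx∈Idp x) refl)) fx∈Idp)

  collision-moved : ∀ {x y} → x ≢ y → f x ≡ f y → Moved x
  collision-moved {x} {y} x≢y fx≡fy x∈Idp =
    x≢y (sym (proj₁ (x∈Idp y) (trans (sym fx≡fy) (idp-fixed x∈Idp))))

  idp-apart : ∀ {x y} → InIdp f x → Moved y → x ≢ y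
  idp-apart x∈Idp y-moved refl = y-moved x∈Idp

module Descent (em : ExcludedMiddle 0ℓ) {A : Set} {S : (A → A) → Set}
  (FS : FunctionSemigroup A S) (FT : FullyTranspositional S) (f : A → A)
  {x₀ y₀ : A} (x₀≢y₀ : x₀ ≢ y₀) (fx₀≡fy₀ : f x₀ ≡ f y₀) where

  open FunctionSemigroup FS
  open Idempotents f

  _≟_ : DecidableEquality A
  x ≟ y = em

  open Transposition _≟_
  open Removal _≟_

  dne : {P : Set} → ¬ ¬ P → P
  dne = em⇒dne em

  x₀-moved : Moved x₀
  x₀-moved = collision-moved x₀≢y₀ fx₀≡fy₀

  y₀-moved : Moved y₀
  y₀-moved = collision-moved (x₀≢y₀ ∘ sym) (sym fx₀≡fy₀)

  Result : Set₁
  Result = Σ (A → A) λ g → S g × SemiConstant g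

  InjectiveOn : (A → A) → List A → Set
  InjectiveOn h Vs = ∀ {p q} → p ∈ Vs → q ∈ Vs → h p ≡ h q → p ≡ q

  record Approximant (h : A → A) (Vs : List A) : Set where
    field
      inS       : S h
      fixesIdp  : ∀ x → InIdp f x → h x ≡ x
      imageIn   : ∀ {x} → Moved x → h x ∈ Vs
      listMoved : ∀ {v} → v ∈ Vs → Moved v
      collapses : h x₀ ≡ h y₀

  Shorter : List A → Set
  Shorter Vs = Σ (A → A) λ h′ → Σ (List A) λ Vs′ →
    Approximant h′ Vs′ × length Vs′ < length Vs

  initial : S f → FiniteImageOutsideIdp f → Σ (List A) (Approximant f)
  initial Sf (L , L-covers) = Vs , record
    { inS       = Sf
    ; fixesIdp  = λ x → idp-fixed
    ; imageIn   = λ x-moved →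
        ∈-filter⁺ (λ z → em) (L-covers _ x-moved) (moved-closed x-moved)
    ; listMoved = λ v∈Vs → proj₂ (∈-filter⁻ (λ z → em) {xs = L} v∈Vs)
    ; collapses = fx₀≡fy₀
    }
    where
      Vs : List A
      Vs = filter (λ z → em {Moved z}) L

  constant⇒semiConstant : ∀ {h Vs} → Approximant h Vs →
    (∀ {x} → Moved x → h x ≡ h x₀) → Result
  constant⇒semiConstant {h} ap constant = h , inS ,
    Moved , (x₀ , y₀ , x₀≢y₀ , x₀-moved , y₀-moved) ,
    (h x₀ , λ x → constant) , λ x x-fixed → fixesIdp x (dne x-fixed)
    where open Approximant ap

  squareStep : ∀ {h Vs p q} → Approximant h Vs → p ∈ Vs → q ∈ Vs →
    p ≢ q → h p ≡ h q → Shorter Vs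
  squareStep {h} {Vs} {p} {q} ap p∈Vs q∈Vs p≢q hp≡hq =
    h ∘ h , Vs′ , ap′ ,
    ≤-<-trans (≤-reflexive (length-map h (Vs without q))) (without-shorter Vs q∈Vs)
    where
      open Approximant ap
      Vs′ : List A
      Vs′ = map h (Vs without q)

      imageIn′ : ∀ {x} → Moved x → h (h x) ∈ Vs′
      imageIn′ {x} x-moved with h x ≟ q
      ... | yes hx≡q = subst (_∈ Vs′) (trans hp≡hq (cong h (sym hx≡q)))
                             (∈-map⁺ h (∈-without⁺ p∈Vs p≢q))
      ... | no hx≢q = ∈-map⁺ h (∈-without⁺ (imageIn x-moved) hx≢q)

      listMoved′ : ∀ {v} → v ∈ Vs′ → Moved v
      listMoved′ v∈Vs′ with ∈-map⁻ h v∈Vs′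
      ... | u , u∈Vs∖q , refl = listMoved (imageIn (listMoved (∈-without⁻ Vs u∈Vs∖q)))

      ap′ : Approximant (h ∘ h) Vs′
      ap′ = record
        { inS       = closed inS inS
        ; fixesIdp  = λ x x∈Idp → trans (cong h (fixesIdp x x∈Idp)) (fixesIdp x x∈Idp)
        ; imageIn   = imageIn′
        ; listMoved = listMoved′
        ; collapses = cong h collapses
        }

  swapStep : ∀ {h Vs v w} → Approximant h Vs → InjectiveOn h Vs →
    Moved w → w ∉ Vs → v ∈ Vs → h v ≢ h w → Shorter Vs
  swapStep {h} {Vs} {v} {w} ap injective w-moved w∉Vs v∈Vs hv≢hw =
    h′ , Vs without h v , ap′ , without-shorter Vs (imageIn (listMoved v∈Vs))
    where
      open Approximant ap
      h′ : A → A
      h′ = h ∘ swap v w ∘ h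

      v≢w : v ≢ w
      v≢w refl = w∉Vs v∈Vs

      imageIn′ : ∀ {x} → Moved x → h′ x ∈ Vs without h v
      imageIn′ {x} x-moved = byCase (h x ≟ v)
        where
          hx∈Vs : h x ∈ Vs
          hx∈Vs = imageIn x-moved

          byCase : Dec (h x ≡ v) → h′ x ∈ Vs without h v
          byCase (yes hx≡v) =
            subst (_∈ Vs without h v) (cong h (sym (trans (cong (swap v w) hx≡v) (swap-left v w))))
                  (∈-without⁺ (imageIn w-moved) (hv≢hw ∘ sym))
          byCase (no hx≢v) =
            subst (_∈ Vs without h v) (cong h (sym (swap-fixes hx≢v hx≢w)))
                  (∈-without⁺ (imageIn (listMoved hx∈Vs)) (hx≢v ∘ injective hx∈Vs v∈Vs))
            where
              hx≢w : h x ≢ w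
              hx≢w refl = w∉Vs hx∈Vs

      fixesIdp′ : ∀ x → InIdp f x → h′ x ≡ x
      fixesIdp′ x x∈Idp = begin
        h (swap v w (h x)) ≡⟨ cong (h ∘ swap v w) (fixesIdp x x∈Idp) ⟩
        h (swap v w x)     ≡⟨ cong h (swap-fixes (idp-apart x∈Idp (listMoved v∈Vs))
                                                 (idp-apart x∈Idp w-moved)) ⟩
        h x                ≡⟨ fixesIdp x x∈Idp ⟩
        x                  ∎
        where open ≡-Reasoning

      ap′ : Approximant h′ (Vs without h v)
      ap′ = record
        { inS       = closed inS (closed (FT _ (swap-isTransposition v≢w)) inS)
        ; fixesIdp  = fixesIdp′
        ; imageIn   = imageIn′
        ; listMoved = listMoved ∘ ∈-without⁻ Vs
        ; collapses = cong (h ∘ swap v w) collapses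
        }

  -- If h is injective on Vs, then Vs does not cover Moved, since
  -- h identifies the two moved points x₀ ≠ y₀.
  outsidePoint : ∀ {h Vs} → Approximant h Vs → InjectiveOn h Vs →
    Σ A λ w → Moved w × w ∉ Vs
  outsidePoint {h} {Vs} ap injective = dne λ noOutside →
    let covered : ∀ {x} → Moved x → x ∈ Vs
        covered x-moved = dne λ x∉Vs → noOutside (_ , x-moved , x∉Vs)
    in x₀≢y₀ (injective (covered x₀-moved) (covered y₀-moved) (Approximant.collapses ap))

  -- Of two distinct entries of a list on which h is injective, at most one
  -- is sent to a given point t.
  avoid : ∀ {h Vs u u′} → InjectiveOn h Vs → u ∈ Vs → u′ ∈ Vs → u ≢ u′ →
    ∀ t → Σ A λ v → v ∈ Vs × h v ≢ t
  avoid {h} {u = u} {u′} injective u∈Vs u′∈Vs u≢u′ t with h u ≟ t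
  ... | no hu≢t = u , u∈Vs , hu≢t
  ... | yes hu≡t = u′ , u′∈Vs , λ hu′≡t →
          u≢u′ (injective u∈Vs u′∈Vs (trans hu≡t (sym hu′≡t)))

  shrink : ∀ {h Vs u u′} → Approximant h Vs → u ∈ Vs → u′ ∈ Vs → u ≢ u′ →
    Shorter Vs
  shrink {h} {Vs} ap u∈Vs u′∈Vs u≢u′
    with em {Σ A λ p → Σ A λ q → p ∈ Vs × q ∈ Vs × p ≢ q × h p ≡ h q}
  ... | yes (p , q , p∈Vs , q∈Vs , p≢q , hp≡hq) = squareStep ap p∈Vs q∈Vs p≢q hp≡hq
  ... | no noCollision = swapStep ap injective w-moved w∉Vs v∈Vs hv≢hw
    where
      injective : InjectiveOn h Vs
      injective {p} {q} p∈Vs q∈Vs hp≡hq =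
        dne λ p≢q → noCollision (p , q , p∈Vs , q∈Vs , p≢q , hp≡hq)
      outside : Σ A λ w → Moved w × w ∉ Vs
      outside = outsidePoint ap injective

      w : A
      w = proj₁ outside

      w-moved : Moved w
      w-moved = proj₁ (proj₂ outside)

      w∉Vs : w ∉ Vs
      w∉Vs = proj₂ (proj₂ outside)

      avoiding : Σ A λ v → v ∈ Vs × h v ≢ h w
      avoiding = avoid injective u∈Vs u′∈Vs u≢u′ (h w)

      v∈Vs : proj₁ avoiding ∈ Vs
      v∈Vs = proj₁ (proj₂ avoiding)

      hv≢hw : h (proj₁ avoiding) ≢ h w
      hv≢hw = proj₂ (proj₂ avoiding)

  descend : ∀ {h Vs} → Acc _<_ (length Vs) → Approximant h Vs → Result
  descend {h} {Vs} (acc smaller) ap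
    with em {Σ A λ u → Σ A λ u′ → u ∈ Vs × u′ ∈ Vs × u ≢ u′}
  ... | yes (u , u′ , u∈Vs , u′∈Vs , u≢u′) =
          let (h′ , Vs′ , ap′ , shorter) = shrink ap u∈Vs u′∈Vs u≢u′
          in descend (smaller shorter) ap′
  ... | no noPair = constant⇒semiConstant ap λ {x} x-moved →
          dne λ hx≢hx₀ → noPair (h x , h x₀ , imageIn x-moved , imageIn x₀-moved , hx≢hx₀)
    where open Approximant ap

mainTheorem12 : ExcludedMiddle 0ℓ →
    (A : Set) (S : (A → A) → Set) →
    FunctionSemigroup A S → FullyTranspositional S →
    (Σ (A → A) λ f → S f × FiniteImageOutsideIdp f × NotInjective f) →
    Σ (A → A) λ g → S g × SemiConstant g
mainTheorem12 em A S FS FT (f , Sf , finite , notInjective) =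
  let (x₀ , y₀ , x₀≢y₀ , fx₀≡fy₀) = collision
      open Descent em FS FT f x₀≢y₀ fx₀≡fy₀
      (Vs , ap) = initial Sf finite
  in descend (<-wellFounded (length Vs)) ap
  where
    dne : {P : Set} → ¬ ¬ P → P
    dne = em⇒dne em

    collision : Σ A λ x → Σ A λ y → x ≢ y × f x ≡ f y
    collision = dne λ noCollision → notInjective λ x y fx≡fy →
      dne λ x≢y → noCollision (x , y , x≢y , fx≡fy)
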